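{- For each integer $k\geq 0$ with $k\neq 2$, there exists a graph universal cycle of the family of all simple labeled graphs on the vertex labels $\{0,1,\ldots,k-1\}$.
   Context: A simple labeled graph on $k$ vertices is a graph without loops or multiple edges whose vertices carry the distinct labels $0,1,\ldots,k-1$; two labeled graphs are regarded as equal if, after identifying vertices with equal labels, they have the same edges. Let $G$ be a labeled graph with vertex set $\{v_0,\ldots,v_{n-1}\}$, where $v_j$ has label $j$, and let $k$ be an integer with $0\leq k\leq n$. For $0\leq i\leq n-1$, the $i$-th $k$-window $W_{G,k}(i)$ of $G$ is the subgraph of $G$ induced by $\{v_i,v_{i+1},\ldots,v_{i+k-1}\}$ (subscripts reduced modulo $n$), relabeled so that $v_{i+t}$ receives label $t$ for $0\leq t\leq k-1$. Given a family $\mathcal F$ of labeled graphs on the labels $\{0,\ldots,k-1\}$, a graph universal cycle (GU-cycle) of $\mathcal F$ is a labeled graph $G$ on some $n$ vertices such that $\{W_{G,k}(i): 0\leq i\leq n-1\}=\mathcal F$ and $W_{G,k}(i)=W_{G,k}(j)$ implies $i=j$ (so each member of $\mathcal F$ occurs as exactly one window). -}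

module Defs where

open import Data.Product using (Σ; _×_)
open import Data.Nat using (ℕ; zero; suc; _+_)
open import Data.Nat.DivMod using (_mod_)
open import Data.Fin using (Fin; toℕ)
open import Data.Bool using (Bool; false)
open import Relation.Binary.PropositionalEquality using (_≡_)

-- A simple labeled graph on the labels 0,…,n-1 (vertex v_j ↔ j : Fin n),
-- given by a symmetric, irreflexive Boolean adjacency relation.
record SimpleGraph (n : ℕ) : Set where
  field
    adj    : Fin n → Fin n → Bool
    sym    : ∀ x y → adj x y ≡ adj y x
    irrefl : ∀ x → adj x x ≡ false
open SimpleGraph public

_≈G_ : {n : ℕ} → SimpleGraph n → SimpleGraph n → Set
G ≈G H = ∀ x y → adj G x y ≡ adj H x y

shift : {n k : ℕ} → Fin n → Fin k → Fin n
shift {suc m} i t = (toℕ i + toℕ t) mod (suc m)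

window : {n : ℕ} (k : ℕ) → SimpleGraph n → Fin n → SimpleGraph k
window k G i = record
  { adj    = λ s t → adj G (shift i s) (shift i t)
  ; sym    = λ s t → sym G (shift i s) (shift i t)
  ; irrefl = λ s → irrefl G (shift i s)
  }

IsGUCycleAll : {n : ℕ} (k : ℕ) → SimpleGraph n → Set
IsGUCycleAll {n} k G =
  (∀ (H : SimpleGraph k) → Σ (Fin n) (λ i → window k G i ≈G H))
  × (∀ (i j : Fin n) → window k G i ≈G window k G j → i ≡ j)

-- Put the n vertices on the cycle ℤ/n and let the chord {u, u + d}, 1 ≤ d ≤ K = k - 1, be an
-- edge iff D (u + triangle (K ∸ d)), for a binary sequence D of period n. When n > 2K each such
-- chord is reached from exactly one endpoint, so the window at i has (s, s + d) as an edge iff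
-- D (i + triangle (K ∸ d) + s), and as (s, d) runs over the pairs of labels, triangle (K ∸ d) + s
-- runs once over [0, triangle K). Windows of G are therefore exactly the length-(triangle K)
-- words of D, and taking D a de Bruijn cycle of order triangle K, of period n = 2 ^ triangle K,
-- makes windows and graphs correspond one-to-one. Only for k = 2 is n > 2K violated.
module Submission where

open import Data.Bool using (Bool; true; false; not; _xor_; _∨_)
open import Data.Bool.Properties
  using (not-¬; not-involutive; xor-assoc; xor-comm; xor-same; xor-identityʳ;
         xor-annihilates-not; not-distribʳ-xor; ∨-comm; ∨-identityʳ)
open import Data.Fin as Fin using (Fin; toℕ; fromℕ<; punchOut; funToFin; finToFun)
open import Data.Fin.Properties
  using (any?; toℕ-injective; toℕ-fromℕ<; toℕ<n; fromℕ<-toℕ; punchOut-injective;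
         injective⇒≤; finToFun-funToFin; 2↔Bool)
open import Data.Nat
open import Data.Nat.DivMod
open import Data.Nat.Properties
open import Data.Nat.Tactic.RingSolver using (solve-∀)
open import Data.Product using (Σ; ∃; ∃₂; _×_; _,_; proj₁; proj₂)
open import Function using (_∘_; Inverse)
open import Function.Definitions using (Injective)
open import Relation.Binary.Definitions using (tri<; tri≈; tri>)
open import Relation.Binary.PropositionalEquality
open import Relation.Nullary using (¬_; yes; no; contradiction)

open import Defs hiding (sym)

private
  variable
    m i i′ j j′ l r r′ s s′ t : ℕ
    f f′ g g′ h : ℕ → Bool

%-absorbˡ : ∀ a b n .{{_ : NonZero n}} → (a % n + b) % n ≡ (a + b) % n
%-absorbˡ a b n = begin
  (a % n + b) % n            ≡⟨ %-distribˡ-+ (a % n) b n ⟩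
  (a % n % n + b % n) % n    ≡⟨ cong (λ c → (c + b % n) % n) (m%n%n≡m%n a n) ⟩
  (a % n + b % n) % n        ≡⟨ %-distribˡ-+ a b n ⟨
  (a + b) % n                ∎
  where open ≡-Reasoning

[n+m]%n≡m%n : ∀ m n .{{_ : NonZero n}} → (n + m) % n ≡ m % n
[n+m]%n≡m%n m n = trans (cong (_% n) (+-comm n m)) ([m+n]%n≡m%n m n)

%-injective : ∀ {n} .{{_ : NonZero n}} → i < n → j < n → i % n ≡ j % n → i ≡ j
%-injective i<n j<n e = trans (sym (m<n⇒m%n≡m i<n)) (trans e (m<n⇒m%n≡m j<n))

%-cancelˡ-+ : ∀ {n i j} p → (p + i) % suc n ≡ (p + j) % suc n → i % suc n ≡ j % suc n
%-cancelˡ-+ {n} {i} {j} p e = begin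
  i % suc n                         ≡⟨ [m+kn]%n≡m%n i p (suc n) ⟨
  (i + p * suc n) % suc n           ≡⟨ cong (_% suc n) (regroup i p n) ⟩
  (p + i + p * n) % suc n           ≡⟨ %-absorbˡ (p + i) (p * n) (suc n) ⟨
  ((p + i) % suc n + p * n) % suc n ≡⟨ cong (λ c → (c + p * n) % suc n) e ⟩
  ((p + j) % suc n + p * n) % suc n ≡⟨ %-absorbˡ (p + j) (p * n) (suc n) ⟩
  (p + j + p * n) % suc n           ≡⟨ cong (_% suc n) (regroup j p n) ⟨
  (j + p * suc n) % suc n           ≡⟨ [m+kn]%n≡m%n j p (suc n) ⟩
  j % suc n                         ∎
  where
  open ≡-Reasoning
  regroup : ∀ a p n → a + p * suc n ≡ p + a + p * n
  regroup = solve-∀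

-- Windows of binary sequences

Seq : Set
Seq = ℕ → Bool

record SameWindow (m : ℕ) (f : Seq) (i : ℕ) (g : Seq) (j : ℕ) : Set where
  constructor sameWindow
  field agree : ∀ t → t < m → f (i + t) ≡ g (j + t)
open SameWindow public

Periodic : Seq → ℕ → Set
Periodic f L = ∀ j → f (j + L) ≡ f j

Δ : Seq → Seq
Δ f j = f j xor f (suc j)

SameWindow-sym : SameWindow m f i g j → SameWindow m g j f i
SameWindow-sym w = sameWindow λ t t<m → sym (agree w t t<m)

SameWindow-trans : SameWindow m f i g j → SameWindow m g j h l → SameWindow m f i h l
SameWindow-trans v w = sameWindow λ t t<m → trans (agree v t t<m) (agree w t t<m)

SameWindow-transfer : SameWindow m h i f i′ → SameWindow m h j g j′ →
                      SameWindow m h i h j → SameWindow m f i′ g j′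
SameWindow-transfer u v w = SameWindow-trans (SameWindow-sym u) (SameWindow-trans w v)

SameWindow-≗ : f ≗ f′ → g ≗ g′ → SameWindow m f i g j → SameWindow m f′ i g′ j
SameWindow-≗ {i = i} {j = j} f≗f′ g≗g′ w = sameWindow λ t t<m →
  trans (sym (f≗f′ (i + t))) (trans (agree w t t<m) (g≗g′ (j + t)))

SameWindow-head : SameWindow (suc m) f i g j → f i ≡ g j
SameWindow-head {f = f} {i = i} {g = g} {j = j} w =
  subst₂ (λ a b → f a ≡ g b) (+-identityʳ i) (+-identityʳ j) (agree w 0 z<s)

SameWindow-init : SameWindow (suc m) f i g j → SameWindow m f i g j
SameWindow-init w = sameWindow λ t t<m → agree w t (m<n⇒m<1+n t<m)

SameWindow-tail : SameWindow (suc m) f i g j → SameWindow m f (suc i) g (suc j)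
SameWindow-tail {f = f} {i = i} {g = g} {j = j} w = sameWindow λ t t<m →
  subst₂ (λ a b → f a ≡ g b) (+-suc i t) (+-suc j t) (agree w (suc t) (s<s t<m))

SameWindow-offset : ∀ p q → SameWindow m (λ k → f (p + k)) i (λ k → g (q + k)) j →
                    SameWindow m f (p + i) g (q + j)
SameWindow-offset {f = f} {i = i} {g = g} {j = j} p q w = sameWindow λ t t<m →
  subst₂ (λ a b → f a ≡ g b) (sym (+-assoc p i t)) (sym (+-assoc q j t)) (agree w t t<m)

Δ-window : SameWindow (suc m) f i g j → SameWindow m (Δ f) i (Δ g) j
Δ-window w = sameWindow λ t t<m →
  cong₂ _xor_ (agree (SameWindow-init w) t t<m) (agree (SameWindow-tail w) t t<m)

module _ {L : ℕ} {f : Seq} (periodic : Periodic f L) where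

  periodic-+* : ∀ j c → f (j + c * L) ≡ f j
  periodic-+* j zero = cong f (+-identityʳ j)
  periodic-+* j (suc c) = begin
    f (j + (L + c * L)) ≡⟨ cong f (regroup j L (c * L)) ⟩
    f (j + c * L + L)   ≡⟨ periodic (j + c * L) ⟩
    f (j + c * L)       ≡⟨ periodic-+* j c ⟩
    f j                 ∎
    where
    open ≡-Reasoning
    regroup : ∀ a b c → a + (b + c) ≡ a + c + b
    regroup = solve-∀

  module _ .{{_ : NonZero L}} where

    periodic-% : ∀ j → f (j % L) ≡ f j
    periodic-% j = begin
      f (j % L)               ≡⟨ periodic-+* (j % L) (j / L) ⟨
      f (j % L + j / L * L)   ≡⟨ cong f (m≡m%n+[m/n]*n j L) ⟨
      f j                     ∎
      where open ≡-Reasoning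

    periodic-%+ : ∀ i t → f (i % L + t) ≡ f (i + t)
    periodic-%+ i t = begin
      f (i % L + t)         ≡⟨ periodic-% (i % L + t) ⟨
      f ((i % L + t) % L)   ≡⟨ cong f (%-absorbˡ i t L) ⟩
      f ((i + t) % L)       ≡⟨ periodic-% (i + t) ⟩
      f (i + t)             ∎
      where open ≡-Reasoning

SameWindow-% : ∀ {L} .{{_ : NonZero L}} → Periodic f L → Periodic g L →
               SameWindow m f i g j → SameWindow m f (i % L) g (j % L)
SameWindow-% {i = i} {j = j} f-per g-per w = sameWindow λ t t<m →
  trans (periodic-%+ f-per i t) (trans (agree w t t<m) (sym (periodic-%+ g-per j t)))

data Half (L : ℕ) : ℕ → Set where
  lower : i < L → Half L i
  upper : s < L → Half L (L + s)

half : ∀ {L} → i < L + L → Half L i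
half {i} {L} i<2L with i <? L
... | yes i<L = lower i<L
... | no i≮L = subst (Half L) L+[i∸L]≡i
                 (upper (+-cancelˡ-< L _ _ (subst (_< L + L) (sym L+[i∸L]≡i) i<2L)))
  where
  L+[i∸L]≡i : L + (i ∸ L) ≡ i
  L+[i∸L]≡i = m+[n∸m]≡n (≮⇒≥ i≮L)

-- De Bruijn cycles

record DistinctWindows (m L : ℕ) (f : Seq) : Set where
  field
    periodic : Periodic f L
    distinct : i < L → j < L → SameWindow m f i f j → i ≡ j

module _ {m P : ℕ} {f : Seq} (dw : DistinctWindows m (suc P) f) where
  open DistinctWindows dw

  windows-residue : SameWindow m f i f j → i % suc P ≡ j % suc P
  windows-residue {i} {j} w =
    distinct (m%n<n i (suc P)) (m%n<n j (suc P)) (SameWindow-% periodic periodic w)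

  rotate : ∀ p → DistinctWindows m (suc P) (λ j → f (p + j))
  rotate p = record
    { periodic = λ j → trans (cong f (sym (+-assoc p j (suc P)))) (periodic (p + j))
    ; distinct = λ {i} {j} i<L j<L w →
        %-injective i<L j<L (%-cancelˡ-+ p (windows-residue (SameWindow-offset p p w)))
    }

fromBool : Bool → Fin 2
fromBool = Inverse.from 2↔Bool

fromBool-injective : ∀ {b b′} → fromBool b ≡ fromBool b′ → b ≡ b′
fromBool-injective {b} {b′} e =
  trans (sym (strictlyInverseˡ b)) (trans (cong to e) (strictlyInverseˡ b′))
  where open Inverse 2↔Bool using (to; strictlyInverseˡ)

windowCode : (m : ℕ) → Seq → ℕ → Fin (2 ^ m)
windowCode m f i = funToFin {m} (λ t → fromBool (f (i + toℕ t)))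

windowCode-injective : windowCode m f i ≡ windowCode m g j → SameWindow m f i g j
windowCode-injective {m = m} {f = f} {i = i} {g = g} {j = j} e = sameWindow λ t t<m →
  subst (λ u → f (i + u) ≡ g (j + u)) (toℕ-fromℕ< t<m) (fromBool-injective (bits (fromℕ< t<m)))
  where
  open ≡-Reasoning
  bits : ∀ t → fromBool (f (i + toℕ t)) ≡ fromBool (g (j + toℕ t))
  bits t = begin
    fromBool (f (i + toℕ t))              ≡⟨ finToFun-funToFin {m = m} _ t ⟨
    finToFun {2} {m} (windowCode m f i) t ≡⟨ cong (λ c → finToFun c t) e ⟩
    finToFun {2} {m} (windowCode m g j) t ≡⟨ finToFun-funToFin {m = m} _ t ⟩
    fromBool (g (j + toℕ t))              ∎

injective⇒surjective : ∀ {n} (φ : Fin n → Fin n) → Injective _≡_ _≡_ φ →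
                       ∀ y → ∃ λ x → φ x ≡ y
injective⇒surjective {suc n} φ φ-injective y with any? (λ x → φ x Fin.≟ y)
... | yes hit = hit
... | no miss = contradiction (injective⇒≤ squeeze-injective) 1+n≰n
  where
  squeeze : Fin (suc n) → Fin n
  squeeze x = punchOut {i = y} (λ y≡φx → miss (x , sym y≡φx))
  squeeze-injective : Injective _≡_ _≡_ squeeze
  squeeze-injective e = φ-injective (punchOut-injective {i = y} _ _ e)

-- Pigeonhole: the 2 ^ m windows of a period are distinct, so they exhaust the 2 ^ m words.
deBruijn-surjective : ∀ {L} → DistinctWindows m L f → L ≡ 2 ^ m →
                      ∀ w → ∃ λ p → p < L × SameWindow m f p w 0
deBruijn-surjective {m = m} {f = f} dw refl w =
  let p , e = injective⇒surjective code code-injective (windowCode m w 0)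
  in toℕ p , toℕ<n p , windowCode-injective e
  where
  code : Fin (2 ^ m) → Fin (2 ^ m)
  code p = windowCode m f (toℕ p)
  code-injective : Injective _≡_ _≡_ code
  code-injective {x} {y} e = toℕ-injective
    (DistinctWindows.distinct dw (toℕ<n x) (toℕ<n y) (windowCode-injective e))

-- Lempel's lift. The running xor-sum x of a has Δ x = a, so equal windows of x of length m + 1
-- give equal windows of a of length m. If x L = true, x has period 2L and is the lift;
-- otherwise x has period L and the lift glues one period of x to one period of x̄, its
-- complement shifted by one. The all-ones prefix of a makes x̄ agree with x on the first m
-- places, so windows straddling the seams still read x or x̄.
module Lift {m P : ℕ} {a : Seq} (a-windows : DistinctWindows m (suc P) a)
            (ones : ∀ t → t < m → a t ≡ true) (m≤L : m ≤ suc P) where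

  L : ℕ
  L = suc P

  open DistinctWindows a-windows

  x : Seq
  x zero = false
  x (suc j) = x j xor a j

  Δx≗a : Δ x ≗ a
  Δx≗a j = trans (sym (xor-assoc (x j) (x j) (a j))) (cong (_xor a j) (xor-same (x j)))

  x-window-residue : SameWindow (suc m) x i x j → i % L ≡ j % L
  x-window-residue w = windows-residue a-windows (SameWindow-≗ Δx≗a Δx≗a (Δ-window w))

  x-+L : ∀ j → x (j + L) ≡ x j xor x L
  x-+L zero = refl
  x-+L (suc j) = begin
    x (j + L) xor a (j + L)   ≡⟨ cong₂ _xor_ (x-+L j) (periodic j) ⟩
    (x j xor x L) xor a j     ≡⟨ xor-assoc (x j) (x L) (a j) ⟩
    x j xor (x L xor a j)     ≡⟨ cong (x j xor_) (xor-comm (x L) (a j)) ⟩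
    x j xor (a j xor x L)     ≡⟨ xor-assoc (x j) (a j) (x L) ⟨
    (x j xor a j) xor x L     ∎
    where open ≡-Reasoning

  module OddParity (x-L≡true : x L ≡ true) where

    x-antiperiodic : ∀ j → x (j + L) ≡ not (x j)
    x-antiperiodic j = trans (x-+L j) (trans (cong (x j xor_) x-L≡true) (xor-comm (x j) true))

    x-periodic : Periodic x (L + L)
    x-periodic j = begin
      x (j + (L + L))   ≡⟨ cong x (+-assoc j L L) ⟨
      x (j + L + L)     ≡⟨ x-antiperiodic (j + L) ⟩
      not (x (j + L))   ≡⟨ cong not (x-antiperiodic j) ⟩
      not (not (x j))   ≡⟨ not-involutive (x j) ⟩
      x j               ∎
      where open ≡-Reasoning

    halves-differ : i < L → s < L → ¬ SameWindow (suc m) x i x (L + s)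
    halves-differ {i} {s} i<L s<L w = not-¬ refl (begin
      x i               ≡⟨ SameWindow-head w ⟩
      x (L + s)         ≡⟨ cong x (+-comm L s) ⟩
      x (s + L)         ≡⟨ x-antiperiodic s ⟩
      not (x s)         ≡⟨ cong (not ∘ x) i≡s ⟨
      not (x i)         ∎)
      where
      open ≡-Reasoning
      i≡s : i ≡ s
      i≡s = %-injective i<L s<L (trans (x-window-residue w) ([n+m]%n≡m%n s L))

    distinct-halves : Half L i → Half L j → SameWindow (suc m) x i x j → i ≡ j
    distinct-halves (lower i<L) (lower j<L) w = %-injective i<L j<L (x-window-residue w)
    distinct-halves (lower i<L) (upper s<L) w = contradiction w (halves-differ i<L s<L)
    distinct-halves (upper s<L) (lower j<L) w =
      contradiction (SameWindow-sym w) (halves-differ j<L s<L)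
    distinct-halves (upper {s} s<L) (upper {s′} s′<L) w =
      cong (L +_) (%-injective s<L s′<L (begin
        s % L         ≡⟨ [n+m]%n≡m%n s L ⟨
        (L + s) % L   ≡⟨ x-window-residue w ⟩
        (L + s′) % L  ≡⟨ [n+m]%n≡m%n s′ L ⟩
        s′ % L        ∎))
      where open ≡-Reasoning

    lifted : DistinctWindows (suc m) (L + L) x
    lifted = record
      { periodic = x-periodic
      ; distinct = λ i<2L j<2L → distinct-halves (half i<2L) (half j<2L)
      }

  module EvenParity (x-L≡false : x L ≡ false) where

    x-periodic : Periodic x L
    x-periodic j = trans (x-+L j) (trans (cong (x j xor_) x-L≡false) (xor-identityʳ (x j)))

    x̄ : Seq
    x̄ j = not (x (suc j))

    x̄-periodic : Periodic x̄ L
    x̄-periodic j = cong not (x-periodic (suc j))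

    x̄≡x-on-prefix : t < m → x̄ t ≡ x t
    x̄≡x-on-prefix {t} t<m = begin
      not (x t xor a t)      ≡⟨ cong (λ b → not (x t xor b)) (ones t t<m) ⟩
      not (x t xor true)     ≡⟨ not-distribʳ-xor (x t) true ⟩
      x t xor false          ≡⟨ xor-identityʳ (x t) ⟩
      x t                    ∎
      where open ≡-Reasoning

    Δx̄≗a∘suc : Δ x̄ ≗ a ∘ suc
    Δx̄≗a∘suc j = trans (xor-annihilates-not (x (suc j)) (x (suc (suc j)))) (Δx≗a (suc j))

    x̄-window-residue : SameWindow (suc m) x̄ s x̄ s′ → suc s % L ≡ suc s′ % L
    x̄-window-residue w = windows-residue a-windows
      (SameWindow-offset 1 1 (SameWindow-≗ Δx̄≗a∘suc Δx̄≗a∘suc (Δ-window w)))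

    x-x̄-differ : ¬ SameWindow (suc m) x i x̄ s
    x-x̄-differ {i} {s} w = not-¬ (begin
      x i                 ≡⟨ periodic-% x-periodic i ⟨
      x (i % L)           ≡⟨ cong x residues ⟩
      x (suc s % L)       ≡⟨ periodic-% x-periodic (suc s) ⟩
      x (suc s)           ∎) (SameWindow-head w)
      where
      open ≡-Reasoning
      residues : i % L ≡ suc s % L
      residues = windows-residue a-windows
        (SameWindow-offset 0 1 (SameWindow-≗ Δx≗a Δx̄≗a∘suc (Δ-window w)))

    glued : ℕ → Bool
    glued r with r <? L
    ... | yes _ = x r
    ... | no _ = x̄ (r ∸ L)

    z : Seq
    z j = glued (j % (L + L))

    glued-lower : r < L → glued r ≡ x r
    glued-lower {r} r<L with r <? L
    ... | yes _ = refl
    ... | no r≮L = contradiction r<L r≮L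

    glued-upper : ∀ s → glued (L + s) ≡ x̄ s
    glued-upper s with L + s <? L
    ... | yes L+s<L = contradiction L+s<L (≤⇒≯ (m≤m+n L s))
    ... | no _ = cong x̄ (m+n∸m≡n L s)

    z-periodic : Periodic z (L + L)
    z-periodic j = cong glued ([m+n]%n≡m%n j (L + L))

    z≡glued : r < L + L → z r ≡ glued r
    z≡glued r<2L = cong glued (m<n⇒m%n≡m r<2L)

    L+m≤L+L : L + m ≤ L + L
    L+m≤L+L = +-monoʳ-≤ L m≤L

    z-lower : r < L + m → z r ≡ x r
    z-lower r<L+m = go (half (<-≤-trans r<L+m L+m≤L+L)) r<L+m
      where
      go : Half L r → r < L + m → z r ≡ x r
      go (lower r<L) _ = trans (z≡glued (<-≤-trans r<L (m≤m+n L L))) (glued-lower r<L)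
      go (upper {u} u<L) L+u<L+m = begin
        z (L + u)      ≡⟨ z≡glued (+-monoʳ-< L u<L) ⟩
        glued (L + u)  ≡⟨ glued-upper u ⟩
        x̄ u            ≡⟨ x̄≡x-on-prefix (+-cancelˡ-< L u m L+u<L+m) ⟩
        x u            ≡⟨ x-periodic u ⟨
        x (u + L)      ≡⟨ cong x (+-comm u L) ⟩
        x (L + u)      ∎
        where open ≡-Reasoning

    z-upper : s < L + m → z (L + s) ≡ x̄ s
    z-upper s<L+m = go (half (<-≤-trans s<L+m L+m≤L+L)) s<L+m
      where
      go : Half L s → s < L + m → z (L + s) ≡ x̄ s
      go (lower s<L) _ = trans (z≡glued (+-monoʳ-< L s<L)) (glued-upper _)
      go (upper {u} u<L) L+u<L+m = begin
        z (L + (L + u))  ≡⟨ cong z (trans (sym (+-assoc L L u)) (+-comm (L + L) u)) ⟩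
        z (u + (L + L))  ≡⟨ z-periodic u ⟩
        z u              ≡⟨ z-lower (<-≤-trans u<m (m≤n+m m L)) ⟩
        x u              ≡⟨ x̄≡x-on-prefix u<m ⟨
        x̄ u              ≡⟨ x̄-periodic u ⟨
        x̄ (u + L)        ≡⟨ cong x̄ (+-comm u L) ⟩
        x̄ (L + u)        ∎
        where
        open ≡-Reasoning
        u<m : u < m
        u<m = +-cancelˡ-< L u m L+u<L+m

    z-window-lower : i < L → SameWindow (suc m) z i x i
    z-window-lower i<L = sameWindow λ t t<1+m → z-lower (+-mono-<-≤ i<L (s≤s⁻¹ t<1+m))

    z-window-upper : s < L → SameWindow (suc m) z (L + s) x̄ s
    z-window-upper {s} s<L = sameWindow λ t t<1+m →
      trans (cong z (+-assoc L s t)) (z-upper (+-mono-<-≤ s<L (s≤s⁻¹ t<1+m)))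

    distinct-halves : Half L i → Half L j → SameWindow (suc m) z i z j → i ≡ j
    distinct-halves (lower i<L) (lower j<L) w = %-injective i<L j<L
      (x-window-residue (SameWindow-transfer (z-window-lower i<L) (z-window-lower j<L) w))
    distinct-halves (lower i<L) (upper s<L) w = contradiction
      (SameWindow-transfer (z-window-lower i<L) (z-window-upper s<L) w) x-x̄-differ
    distinct-halves (upper s<L) (lower j<L) w = contradiction
      (SameWindow-transfer (z-window-lower j<L) (z-window-upper s<L) (SameWindow-sym w)) x-x̄-differ
    distinct-halves (upper {s} s<L) (upper {s′} s′<L) w = cong (L +_) (%-injective s<L s′<L
      (%-cancelˡ-+ {P} {s} {s′} 1 (x̄-window-residue
        (SameWindow-transfer (z-window-upper s<L) (z-window-upper s′<L) w))))

    lifted : DistinctWindows (suc m) (L + L) z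
    lifted = record
      { periodic = z-periodic
      ; distinct = λ i<2L j<2L → distinct-halves (half i<2L) (half j<2L)
      }

  lift : ∃ (DistinctWindows (suc m) (L + L))
  lift with x L in eq
  ... | true = x , OddParity.lifted eq
  ... | false = EvenParity.z eq , EvenParity.lifted eq

n<2^n : ∀ n → n < 2 ^ n
n<2^n zero = z<s
n<2^n (suc n) = begin-strict
  suc n           <⟨ s<s (n<2^n n) ⟩
  suc (2 ^ n)     ≤⟨ +-monoˡ-≤ (2 ^ n) (m^n>0 2 n) ⟩
  2 ^ n + 2 ^ n   ≡⟨ cong (2 ^ n +_) (+-identityʳ (2 ^ n)) ⟨
  2 ^ suc n       ∎
  where open ≤-Reasoning

-- The period is written suc P, so that reduction modulo it needs no NonZero instance.
record DeBruijnCycle (m : ℕ) : Set where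
  field
    {P}      : ℕ
    sequence : Seq
    length   : suc P ≡ 2 ^ m
    windows  : DistinctWindows m (suc P) sequence

liftDeBruijnCycle : DeBruijnCycle m → DeBruijnCycle (suc m)
liftDeBruijnCycle {m} C = record
  { sequence = proj₁ lifted
  ; length   = cong₂ _+_ length (trans length (sym (+-identityʳ (2 ^ m))))
  ; windows  = proj₂ lifted
  }
  where
  open DeBruijnCycle C
  ones = deBruijn-surjective windows length (λ _ → true)
  m≤L : m ≤ suc P
  m≤L = <⇒≤ (subst (m <_) (sym length) (n<2^n m))
  lifted = Lift.lift (rotate windows (proj₁ ones)) (agree (proj₂ (proj₂ ones))) m≤L

deBruijnCycle : ∀ m → DeBruijnCycle m
deBruijnCycle zero = record
  { sequence = λ _ → true
  ; length   = refl
  ; windows  = record { periodic = λ _ → refl ; distinct = λ { z<s z<s _ → refl } }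
  }
deBruijnCycle (suc m) = liftDeBruijnCycle (deBruijnCycle m)

-- Triangular numbers

triangle : ℕ → ℕ
triangle zero = 0
triangle (suc r) = triangle r + suc r

triangle-mono-≤ : r ≤ r′ → triangle r ≤ triangle r′
triangle-mono-≤ z≤n = z≤n
triangle-mono-≤ (s≤s r≤r′) = +-mono-≤ (triangle-mono-≤ r≤r′) (s≤s r≤r′)

triangle-+-< : s ≤ r → r < r′ → triangle r + s < triangle r′
triangle-+-< {s} {r} {r′} s≤r r<r′ = begin-strict
  triangle r + s      <⟨ +-monoʳ-< (triangle r) (s≤s s≤r) ⟩
  triangle (suc r)    ≤⟨ triangle-mono-≤ r<r′ ⟩
  triangle r′         ∎
  where open ≤-Reasoning

triangle-+-<⇒< : triangle r + s < triangle r′ → r < r′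
triangle-+-<⇒< {r} {s} {r′} lt = ≰⇒> λ r′≤r →
  <⇒≱ lt (≤-trans (triangle-mono-≤ r′≤r) (m≤m+n (triangle r) s))

triangle-decompose : ∀ q → ∃₂ λ r s → s ≤ r × q ≡ triangle r + s
triangle-decompose zero = 0 , 0 , z≤n , refl
triangle-decompose (suc q) with triangle-decompose q
... | r , s , s≤r , refl with s <? r
...   | yes s<r = r , suc s , s<r , sym (+-suc (triangle r) s)
...   | no s≮r = suc r , 0 , z≤n , (begin
  suc (triangle r + s)   ≡⟨ cong (λ u → suc (triangle r + u)) (≤-antisym s≤r (≮⇒≥ s≮r)) ⟩
  suc (triangle r + r)   ≡⟨ +-suc (triangle r) r ⟨
  triangle (suc r)       ≡⟨ +-identityʳ _ ⟨
  triangle (suc r) + 0   ∎)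
  where open ≡-Reasoning

triangle-decompose-unique : s ≤ r → s′ ≤ r′ → triangle r + s ≡ triangle r′ + s′ →
                            r ≡ r′ × s ≡ s′
triangle-decompose-unique {s} {r} {s′} {r′} s≤r s′≤r′ e with <-cmp r r′
... | tri< r<r′ _ _ = contradiction e (<⇒≢ (<-≤-trans (triangle-+-< s≤r r<r′) (m≤m+n _ s′)))
... | tri> _ _ r′<r = contradiction (sym e) (<⇒≢ (<-≤-trans (triangle-+-< s′≤r′ r′<r) (m≤m+n _ s)))
... | tri≈ _ refl _ = refl , +-cancelˡ-≡ (triangle r) s s′ e

2+n<triangle[2+n] : ∀ n → 2 + n < triangle (2 + n)
2+n<triangle[2+n] n = m<n+m (2 + n) (<-≤-trans z<s (m≤n+m (suc n) (triangle n)))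

n+n≤2^n : ∀ n → n + n ≤ 2 ^ n
n+n≤2^n zero = z≤n
n+n≤2^n (suc n) = +-mono-≤ (n<2^n n) (subst (suc n ≤_) (sym (+-identityʳ (2 ^ n))) (n<2^n n))

K+K<2^triangleK : ∀ K → K ≢ 1 → K + K < 2 ^ triangle K
K+K<2^triangleK zero _ = z<s
K+K<2^triangleK (suc zero) K≢1 = contradiction refl K≢1
K+K<2^triangleK K@(suc (suc K′)) _ =
  <-≤-trans (+-mono-< K<N K<N) (n+n≤2^n (triangle K))
  where K<N = 2+n<triangle[2+n] K′

-- Chord graphs

-- Labels ≥ k get the junk value false.
adjℕ : ∀ {k} → SimpleGraph k → ℕ → ℕ → Bool
adjℕ {k} H a b with a <? k | b <? k
... | yes a<k | yes b<k = adj H (fromℕ< a<k) (fromℕ< b<k)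
... | _       | _       = false

adjℕ-toℕ : ∀ {k} (H : SimpleGraph k) x y → adjℕ H (toℕ x) (toℕ y) ≡ adj H x y
adjℕ-toℕ {k} H x y with toℕ x <? k | toℕ y <? k
... | yes x<k | yes y<k = cong₂ (adj H) (fromℕ<-toℕ x x<k) (fromℕ<-toℕ y y<k)
... | no x≮k  | _       = contradiction (toℕ<n x) x≮k
... | yes _   | no y≮k  = contradiction (toℕ<n y) y≮k

≈G-from-< : ∀ {k} {G H : SimpleGraph k} →
            (∀ x y → toℕ x < toℕ y → adj G x y ≡ adj H x y) → G ≈G H
≈G-from-< {G = G} {H} agree-< x y with <-cmp (toℕ x) (toℕ y)
... | tri< x<y _ _ = agree-< x y x<y
... | tri≈ _ x≡y _ rewrite toℕ-injective x≡y = trans (irrefl G y) (sym (irrefl H y))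
... | tri> _ _ y<x =
  trans (SimpleGraph.sym G x y) (trans (agree-< y x y<x) (SimpleGraph.sym H y x))

module ChordGraph {K P : ℕ} {D : Seq} (D-periodic : Periodic D (suc P))
                  (K+K<n : K + K < suc P) where

  n : ℕ
  n = suc P

  gap : ℕ → ℕ → ℕ
  gap u v = (v + (n ∸ u)) % n

  gap-self : ∀ {u} → u ≤ n → gap u u ≡ 0
  gap-self u≤n = trans (cong (_% n) (m+[n∸m]≡n u≤n)) (n%n≡0 n)

  gap-+ : ∀ {u d} → u < n → d < n → gap u ((u + d) % n) ≡ d
  gap-+ {u} {d} u<n d<n = begin
    ((u + d) % n + (n ∸ u)) % n   ≡⟨ %-absorbˡ (u + d) (n ∸ u) n ⟩
    (u + d + (n ∸ u)) % n         ≡⟨ cong (_% n) (regroup u d (n ∸ u)) ⟩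
    (d + (u + (n ∸ u))) % n       ≡⟨ cong (λ c → (d + c) % n) (m+[n∸m]≡n (<⇒≤ u<n)) ⟩
    (d + n) % n                   ≡⟨ [m+n]%n≡m%n d n ⟩
    d % n                         ≡⟨ m<n⇒m%n≡m d<n ⟩
    d                             ∎
    where
    open ≡-Reasoning
    regroup : ∀ a b c → a + b + c ≡ b + (a + c)
    regroup = solve-∀

  +-∸-%-inverse : ∀ {u d} → u < n → d ≤ n → ((u + d) % n + (n ∸ d)) % n ≡ u
  +-∸-%-inverse {u} {d} u<n d≤n = begin
    ((u + d) % n + (n ∸ d)) % n   ≡⟨ %-absorbˡ (u + d) (n ∸ d) n ⟩
    (u + d + (n ∸ d)) % n         ≡⟨ cong (_% n) (+-assoc u d (n ∸ d)) ⟩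
    (u + (d + (n ∸ d))) % n       ≡⟨ cong (λ c → (u + c) % n) (m+[n∸m]≡n d≤n) ⟩
    (u + n) % n                   ≡⟨ [m+n]%n≡m%n u n ⟩
    u % n                         ≡⟨ m<n⇒m%n≡m u<n ⟩
    u                             ∎
    where open ≡-Reasoning

  arc : ℕ → ℕ → Bool
  arc u zero = false
  arc u (suc e) with suc e ≤? K
  ... | yes _ = D (u + triangle (K ∸ suc e))
  ... | no _  = false

  arc-short : ∀ {u d} → 0 < d → d ≤ K → arc u d ≡ D (u + triangle (K ∸ d))
  arc-short {d = suc e} _ d≤K with suc e ≤? K
  ... | yes _   = refl
  ... | no d≰K  = contradiction d≤K d≰K

  arc-long : ∀ {u d} → K < d → arc u d ≡ false
  arc-long {d = suc e} K<d with suc e ≤? K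
  ... | yes d≤K = contradiction d≤K (<⇒≱ K<d)
  ... | no _    = refl

  edge : ℕ → ℕ → Bool
  edge u v = arc u (gap u v) ∨ arc v (gap v u)

  edge-sym : ∀ u v → edge u v ≡ edge v u
  edge-sym u v = ∨-comm (arc u (gap u v)) (arc v (gap v u))

  edge-irrefl : ∀ {u} → u ≤ n → edge u u ≡ false
  edge-irrefl u≤n = cong₂ _∨_ loop loop
    where loop = cong (arc _) (gap-self u≤n)

  G : SimpleGraph n
  G = record
    { adj    = λ a b → edge (toℕ a) (toℕ b)
    ; sym    = λ a b → edge-sym (toℕ a) (toℕ b)
    ; irrefl = λ a → edge-irrefl (<⇒≤ (toℕ<n a))
    }

  edge-chord : ∀ {u d} → u < n → 0 < d → d ≤ K →
               edge u ((u + d) % n) ≡ D (u + triangle (K ∸ d))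
  edge-chord {u} {d} u<n 0<d d≤K = begin
    arc u (gap u v) ∨ arc v (gap v u)   ≡⟨ cong₂ _∨_ (cong (arc u) (gap-+ u<n d<n))
                                                     (cong (arc v) gap-back) ⟩
    arc u d ∨ arc v (n ∸ d)             ≡⟨ cong₂ _∨_ (arc-short 0<d d≤K) (arc-long K<n∸d) ⟩
    D (u + triangle (K ∸ d)) ∨ false    ≡⟨ ∨-identityʳ _ ⟩
    D (u + triangle (K ∸ d))            ∎
    where
    open ≡-Reasoning
    v = (u + d) % n
    K+d<n : K + d < n
    K+d<n = ≤-<-trans (+-monoʳ-≤ K d≤K) K+K<n
    d<n : d < n
    d<n = ≤-<-trans (m≤n+m d K) K+d<n
    K<n∸d : K < n ∸ d
    K<n∸d = m+n≤o⇒m≤o∸n (suc K) K+d<n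
    gap-back : gap v u ≡ n ∸ d
    gap-back = begin
      gap v u                          ≡⟨ cong (gap v) (+-∸-%-inverse u<n (<⇒≤ d<n)) ⟨
      gap v ((v + (n ∸ d)) % n)        ≡⟨ gap-+ (m%n<n (u + d) n) (∸-monoʳ-< 0<d (<⇒≤ d<n)) ⟩
      n ∸ d                            ∎

  window-adj : ∀ {r} (i : Fin n) (x y : Fin (suc K)) → toℕ x + (K ∸ r) ≡ toℕ y → r < K →
               adj (window (suc K) G i) x y ≡ D (toℕ i + (triangle r + toℕ x))
  window-adj {r} i x y x+d≡y r<K = begin
    edge (toℕ (shift i x)) (toℕ (shift i y))
      ≡⟨ cong₂ edge (toℕ-fromℕ< _) (trans (toℕ-fromℕ< _) y-pos) ⟩
    edge u ((u + d) % n)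
      ≡⟨ edge-chord (m%n<n (toℕ i + toℕ x) n) 0<d (m∸n≤m K r) ⟩
    D (u + triangle (K ∸ d))
      ≡⟨ cong (λ c → D (u + triangle c)) (m∸[m∸n]≡n (<⇒≤ r<K)) ⟩
    D (u + triangle r)
      ≡⟨ periodic-%+ D-periodic (toℕ i + toℕ x) (triangle r) ⟩
    D (toℕ i + toℕ x + triangle r)
      ≡⟨ cong D (regroup (toℕ i) (toℕ x) (triangle r)) ⟩
    D (toℕ i + (triangle r + toℕ x))
      ∎
    where
    open ≡-Reasoning
    d = K ∸ r
    u = (toℕ i + toℕ x) % n
    0<d : 0 < d
    0<d = m<n⇒0<n∸m r<K
    regroup : ∀ a b c → a + b + c ≡ a + (c + b)
    regroup = solve-∀
    y-pos : (toℕ i + toℕ y) % n ≡ (u + d) % n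
    y-pos = begin
      (toℕ i + toℕ y) % n         ≡⟨ cong (λ c → (toℕ i + c) % n) x+d≡y ⟨
      (toℕ i + (toℕ x + d)) % n   ≡⟨ cong (_% n) (+-assoc (toℕ i) (toℕ x) d) ⟨
      (toℕ i + toℕ x + d) % n     ≡⟨ %-absorbˡ (toℕ i + toℕ x) d n ⟨
      (u + d) % n                 ∎

module ChordGUCycle {K : ℕ} (C : DeBruijnCycle (triangle K))
                    (K+K<n : K + K < suc (DeBruijnCycle.P C)) where

  open DeBruijnCycle C
  open DistinctWindows windows
  open ChordGraph {K} periodic K+K<n

  k : ℕ
  k = suc K

  -- The word that a window showing H carries.
  pairWord : SimpleGraph k → Seq
  pairWord H q with triangle-decompose q
  ... | r , s , _ = adjℕ H s (s + (K ∸ r))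

  pairWord-triangle : ∀ H → s ≤ r → pairWord H (triangle r + s) ≡ adjℕ H s (s + (K ∸ r))
  pairWord-triangle {s} {r} H s≤r with triangle-decompose (triangle r + s)
  ... | r′ , s′ , s′≤r′ , e with triangle-decompose-unique s≤r s′≤r′ e
  ... | refl , refl = refl

  window-injective : ∀ i j → window k G i ≈G window k G j → i ≡ j
  window-injective i j Wᵢ≈Wⱼ = toℕ-injective (distinct (toℕ<n i) (toℕ<n j) (sameWindow same))
    where
    same : ∀ q → q < triangle K → sequence (toℕ i + q) ≡ sequence (toℕ j + q)
    same q q<N with r , s , s≤r , refl ← triangle-decompose q = begin
      sequence (toℕ i + (triangle r + s))   ≡⟨ entry i ⟨
      adj (window k G i) x y                ≡⟨ Wᵢ≈Wⱼ x y ⟩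
      adj (window k G j) x y                ≡⟨ entry j ⟩
      sequence (toℕ j + (triangle r + s))   ∎
      where
      open ≡-Reasoning
      r<K : r < K
      r<K = triangle-+-<⇒< q<N
      x y : Fin k
      x = fromℕ< (s≤s (≤-trans s≤r (<⇒≤ r<K)))
      y = fromℕ< (s≤s (≤-trans (+-monoˡ-≤ (K ∸ r) s≤r) (≤-reflexive (m+[n∸m]≡n (<⇒≤ r<K)))))
      x+d≡y : toℕ x + (K ∸ r) ≡ toℕ y
      x+d≡y = trans (cong (_+ (K ∸ r)) (toℕ-fromℕ< _)) (sym (toℕ-fromℕ< _))
      entry : ∀ l → adj (window k G l) x y ≡ sequence (toℕ l + (triangle r + s))
      entry l = trans (window-adj l x y x+d≡y r<K)
        (cong (λ c → sequence (toℕ l + (triangle r + c))) (toℕ-fromℕ< _))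

  window-surjective : ∀ H → Σ (Fin n) λ i → window k G i ≈G H
  window-surjective H with p , p<n , p-window ← deBruijn-surjective windows length (pairWord H) =
    start , ≈G-from-< {G = window k G start} {H} agrees-above-diagonal
    where
    start : Fin n
    start = fromℕ< p<n
    agrees-above-diagonal : ∀ x y → toℕ x < toℕ y → adj (window k G start) x y ≡ adj H x y
    agrees-above-diagonal x y x<y = begin
      adj (window k G start) x y
        ≡⟨ window-adj start x y x+d≡y ρ<K ⟩
      sequence (toℕ start + (triangle ρ + toℕ x))
        ≡⟨ cong (λ c → sequence (c + (triangle ρ + toℕ x))) (toℕ-fromℕ< p<n) ⟩
      sequence (p + (triangle ρ + toℕ x))
        ≡⟨ agree p-window _ (triangle-+-< x≤ρ ρ<K) ⟩
      pairWord H (triangle ρ + toℕ x)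
        ≡⟨ pairWord-triangle H x≤ρ ⟩
      adjℕ H (toℕ x) (toℕ x + (K ∸ ρ))
        ≡⟨ cong (adjℕ H (toℕ x)) x+d≡y ⟩
      adjℕ H (toℕ x) (toℕ y)
        ≡⟨ adjℕ-toℕ H x y ⟩
      adj H x y
        ∎
      where
      open ≡-Reasoning
      d = toℕ y ∸ toℕ x
      ρ = K ∸ d
      x+d≡y′ : toℕ x + d ≡ toℕ y
      x+d≡y′ = m+[n∸m]≡n (<⇒≤ x<y)
      y≤K : toℕ y ≤ K
      y≤K = s≤s⁻¹ (toℕ<n y)
      d≤K : d ≤ K
      d≤K = ≤-trans (m∸n≤m (toℕ y) (toℕ x)) y≤K
      x+d≡y : toℕ x + (K ∸ ρ) ≡ toℕ y
      x+d≡y = trans (cong (toℕ x +_) (m∸[m∸n]≡n d≤K)) x+d≡y′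
      ρ<K : ρ < K
      ρ<K = ∸-monoʳ-< (m<n⇒0<n∸m x<y) d≤K
      x≤ρ : toℕ x ≤ ρ
      x≤ρ = m+n≤o⇒m≤o∸n (toℕ x) (subst (_≤ K) (sym x+d≡y′) y≤K)

  guCycle : Σ (SimpleGraph n) (IsGUCycleAll k)
  guCycle = G , window-surjective , window-injective

mainTheorem1 : (k : ℕ) → k ≢ 2 →
    Σ ℕ (λ n → k ≤ n × Σ (SimpleGraph n) (λ G → IsGUCycleAll k G))
mainTheorem1 zero _ =
  1 , z≤n , edgeless , (λ _ → Fin.zero , λ ()) , λ { Fin.zero Fin.zero _ → refl }
  where
  edgeless : SimpleGraph 1
  edgeless = record { adj = λ _ _ → false ; sym = λ _ _ → refl ; irrefl = λ _ → refl }
mainTheorem1 (suc K) k≢2 = suc P , ≤-trans (s≤s (m≤m+n K K)) K+K<n , guCycle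
  where
  C = deBruijnCycle (triangle K)
  open DeBruijnCycle C using (P; length)
  K+K<n : K + K < suc P
  K+K<n = subst (K + K <_) (sym length) (K+K<2^triangleK K (k≢2 ∘ cong suc))
  open ChordGUCycle {K} C K+K<n using (guCycle)
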